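{- Let $\mathbb{A}$ be a first-order expansion of $C^2_{\omega}=(A;E)$ preserved by an oligopotent quasi near-unanimity operation and by a ternary canonical operation $h$ with $h(N,\cdot,\cdot)=h(\cdot,N,\cdot)=h(\cdot,\cdot,N)=N$ which behaves like a minority on $\{E,=\}$. Then $\mathbb{A}$ pp-defines neither a $[(E(x_1,x_2)\Rightarrow E(x_3,x_4)),(E^{=}(x_1,x_2)\wedge N(x_2,x_3)\wedge E^{=}(x_3,x_4))]$-relation nor a $[(x_1=x_2\Rightarrow x_3=x_4),(E^{=}(x_1,x_2)\wedge N(x_2,x_3)\wedge E^{=}(x_3,x_4))]$-relation.
   Context: $C^2_{\omega}$ is the countable graph that is a disjoint union of countably infinitely many edges; it is homogeneous, and the orbits of pairs under its automorphism group are $E$, $N:=\{(a,b):a\ne b,(a,b)\notin E\}$ and $=$. $E^{=}:=E\cup\{(a,a):a\in A\}$. A first-order expansion is a structure $(A;E,R_1,\dots,R_k)$ over a finite relational signature with each $R_i$ first-order definable in $(A;E)$; by convention it contains $=$, and $N$ whenever $N$ is pp-definable in it. pp-definable: definable from atomic formulas and equality by conjunction and existential quantification. An operation preserves $\mathbb{A}$ if applied coordinatewise to tuples of any relation it yields a tuple of that relation. A $k$-ary $q$ is a quasi near-unanimity operation if $q(y,x,\dots,x)=q(x,y,x,\dots,x)=\dots=q(x,\dots,x,y)=q(x,\dots,x)$ for all $x,y$; oligopotent if $x\mapsto q(x,\dots,x)$ lies in the closure (pointwise convergence) of the monoid generated by the permutations of $A$ that are polymorphisms of $\mathbb{A}$.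 $h:A^3\to A$ is canonical if for all $m$, automorphisms $\alpha_1,\alpha_2,\alpha_3$ of $(A;E)$ and $m$-tuples $a_1,a_2,a_3$ there is an automorphism $\beta$ with $\beta(h(\alpha_1(a_1),\alpha_2(a_2),\alpha_3(a_3)))=h(a_1,a_2,a_3)$; then $h(O_1,O_2,O_3)$ for $O_i\in\{E,N,=\}$ denotes the orbit of $(h(a_1,a_2,a_3),h(b_1,b_2,b_3))$ for any $(a_i,b_i)\in O_i$. $h(N,\cdot,\cdot)=N$ means $h(N,O_2,O_3)=N$ for all $O_2,O_3$ (similarly for other positions). Behaving like a minority on $\{E,=\}$ means $h(E,E,E)=h(E,=,=)=h(=,E,=)=h(=,=,E)=E$ and $h(=,=,=)=h(=,E,E)=h(E,=,E)=h(E,E,=)$ is $=$. A quaternary $R$ entails $\varphi$ if all its tuples satisfy it; it efficiently entails $(S_1(x_1,x_2)\Rightarrow S_2(x_3,x_4))$ if it entails it and contains $t_1$ with $(t_1[1],t_1[2])\in S_1,(t_1[3],t_1[4])\in S_2$ and $t_2$ with $(t_2[1],t_2[2])\notin S_1,(t_2[3],t_2[4])\notin S_2$. A $[(S_1\Rightarrow S_2),(\varphi)]$-relation efficiently entails the implication and entails $\varphi$. -}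

module Defs where

open import Data.Nat using (ℕ; suc)
open import Data.Bool using (Bool)
open import Data.Fin using (Fin; zero; suc)
open import Data.Product using (Σ; _×_; _,_)
open import Data.Sum using (_⊎_)
open import Data.Empty using (⊥)
open import Data.List using (List)
open import Data.List.Relation.Unary.All using (All)
open import Data.Vec.Functional using (_∷_; updateAt)
open import Function using (id; _∘_; const)
open import Relation.Nullary using (¬_)
open import Relation.Binary.PropositionalEquality using (_≡_; _≢_)

-- The graph C²_ω : vertices (i , b), edges exactly between (i , b) and (i , not b).

A : Set
A = ℕ × Bool

E : A → A → Set
E (i , b) (j , c) = (i ≡ j) × (b ≢ c)

N : A → A → Set
N a b = (a ≢ b) × ¬ E a b

E⁼ : A → A → Set
E⁼ a b = E a b ⊎ a ≡ b

-- First-order formulas over the signature {E} (with equality),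
-- de Bruijn variables, n free variables.

data FO (n : ℕ) : Set where
  falseF : FO n
  eqF    : Fin n → Fin n → FO n
  edgeF  : Fin n → Fin n → FO n
  notF   : FO n → FO n
  andF   : FO n → FO n → FO n
  orF    : FO n → FO n → FO n
  impF   : FO n → FO n → FO n
  allF   : FO (suc n) → FO n
  exF    : FO (suc n) → FO n

⟦_⟧FO : ∀ {n} → FO n → (Fin n → A) → Set
⟦ falseF ⟧FO ρ = ⊥
⟦ eqF i j ⟧FO ρ = ρ i ≡ ρ j
⟦ edgeF i j ⟧FO ρ = E (ρ i) (ρ j)
⟦ notF φ ⟧FO ρ = ¬ ⟦ φ ⟧FO ρ
⟦ andF φ ψ ⟧FO ρ = ⟦ φ ⟧FO ρ × ⟦ ψ ⟧FO ρ
⟦ orF φ ψ ⟧FO ρ = ⟦ φ ⟧FO ρ ⊎ ⟦ ψ ⟧FO ρ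
⟦ impF φ ψ ⟧FO ρ = ⟦ φ ⟧FO ρ → ⟦ ψ ⟧FO ρ
⟦ allF φ ⟧FO ρ = (a : A) → ⟦ φ ⟧FO (a ∷ ρ)
⟦ exF φ ⟧FO ρ = Σ A λ a → ⟦ φ ⟧FO (a ∷ ρ)

Rel : ℕ → Set₁
Rel n = (Fin n → A) → Set

FODefinable : ∀ {n} → Rel n → Set
FODefinable {n} R = Σ (FO n) λ φ → (t : Fin n → A) → (R t → ⟦ φ ⟧FO t) × (⟦ φ ⟧FO t → R t)

record Expansion : Set₁ where
  field
    k     : ℕ
    arity : Fin k → ℕ
    rel   : (r : Fin k) → Rel (arity r)
    fo    : (r : Fin k) → FODefinable (rel r)
open Expansion public

data PP (𝔸 : Expansion) (n : ℕ) : Set where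
  eqP   : Fin n → Fin n → PP 𝔸 n
  edgeP : Fin n → Fin n → PP 𝔸 n
  relP  : (r : Fin (k 𝔸)) → (Fin (arity 𝔸 r) → Fin n) → PP 𝔸 n
  andP  : PP 𝔸 n → PP 𝔸 n → PP 𝔸 n
  exP   : PP 𝔸 (suc n) → PP 𝔸 n

⟦_⟧PP : ∀ {𝔸 n} → PP 𝔸 n → (Fin n → A) → Set
⟦ eqP i j ⟧PP ρ = ρ i ≡ ρ j
⟦ edgeP i j ⟧PP ρ = E (ρ i) (ρ j)
⟦_⟧PP {𝔸} (relP r σ) ρ = rel 𝔸 r (ρ ∘ σ)
⟦ andP φ ψ ⟧PP ρ = ⟦ φ ⟧PP ρ × ⟦ ψ ⟧PP ρ
⟦ exP φ ⟧PP ρ = Σ A λ a → ⟦ φ ⟧PP (a ∷ ρ)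

PPDefinable : (𝔸 : Expansion) → ∀ {n} → Rel n → Set
PPDefinable 𝔸 {n} R = Σ (PP 𝔸 n) λ φ → (t : Fin n → A) → (R t → ⟦ φ ⟧PP t) × (⟦ φ ⟧PP t → R t)

Op : ℕ → Set
Op m = (Fin m → A) → A

Preserves : ∀ {m n} → Op m → Rel n → Set
Preserves {m} {n} f R =
  (t : Fin m → Fin n → A) → ((i : Fin m) → R (t i)) → R (λ j → f (λ i → t i j))

Erel : Rel 2
Erel t = E (t zero) (t (suc zero))

PreservesStr : ∀ {m} → Expansion → Op m → Set
PreservesStr 𝔸 f = Preserves f Erel × ((r : Fin (k 𝔸)) → Preserves f (rel 𝔸 r))

unaryOp : (A → A) → Op 1
unaryOp g t = g (t zero)

ternaryOp : (A → A → A → A) → Op 3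
ternaryOp h t = h (t zero) (t (suc zero)) (t (suc (suc zero)))

IsPermutation : (A → A) → Set
IsPermutation p = Σ (A → A) λ g → ((x : A) → g (p x) ≡ x) × ((x : A) → p (g x) ≡ x)

data InGenMonoid (𝔸 : Expansion) : (A → A) → Set where
  idM   : InGenMonoid 𝔸 id
  stepM : ∀ {p f} → IsPermutation p → PreservesStr 𝔸 (unaryOp p) →
          InGenMonoid 𝔸 f → InGenMonoid 𝔸 (p ∘ f)

-- g lies in the closure (pointwise convergence topology) of that monoid:
-- on every finite set it agrees with some element of the monoid
InClosureGenMonoid : Expansion → (A → A) → Set
InClosureGenMonoid 𝔸 g =
  (F : List A) → Σ (A → A) λ m → InGenMonoid 𝔸 m × All (λ x → m x ≡ g x) F

QuasiNU : ∀ {m} → Op m → Set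
QuasiNU {m} q = (x y : A) (i : Fin m) → q (updateAt (const x) i (const y)) ≡ q (const x)

Oligopotent : ∀ {m} → Expansion → Op m → Set
Oligopotent 𝔸 q = InClosureGenMonoid 𝔸 (λ x → q (const x))

IsAut : (A → A) → Set
IsAut α = IsPermutation α × ((a b : A) → (E a b → E (α a) (α b)) × (E (α a) (α b) → E a b))

Canonical : (A → A → A → A) → Set
Canonical h =
  (m : ℕ) (α₁ α₂ α₃ : A → A) → IsAut α₁ → IsAut α₂ → IsAut α₃ →
  (a₁ a₂ a₃ : Fin m → A) →
  Σ (A → A) λ β → IsAut β ×
    ((j : Fin m) → β (h (α₁ (a₁ j)) (α₂ (a₂ j)) (α₃ (a₃ j))) ≡ h (a₁ j) (a₂ j) (a₃ j))

data Orbit : Set where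
  oE oN oEq : Orbit

InOrbit : Orbit → A → A → Set
InOrbit oE  a b = E a b
InOrbit oN  a b = N a b
InOrbit oEq a b = a ≡ b

HOrb : (A → A → A → A) → Orbit → Orbit → Orbit → Orbit → Set
HOrb h O₁ O₂ O₃ O =
  (a₁ b₁ a₂ b₂ a₃ b₃ : A) → InOrbit O₁ a₁ b₁ → InOrbit O₂ a₂ b₂ → InOrbit O₃ a₃ b₃ →
  InOrbit O (h a₁ a₂ a₃) (h b₁ b₂ b₃)

NPreserving : (A → A → A → A) → Set
NPreserving h = ((O₂ O₃ : Orbit) → HOrb h oN O₂ O₃ oN)
              × ((O₁ O₃ : Orbit) → HOrb h O₁ oN O₃ oN)
              × ((O₁ O₂ : Orbit) → HOrb h O₁ O₂ oN oN)

MinorityOnEEq : (A → A → A → A) → Set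
MinorityOnEEq h =
  HOrb h oE oE oE oE × HOrb h oE oEq oEq oE × HOrb h oEq oE oEq oE × HOrb h oEq oEq oE oE ×
  HOrb h oEq oEq oEq oEq × HOrb h oEq oE oE oEq × HOrb h oE oEq oE oEq × HOrb h oE oE oEq oEq

x₁ x₂ x₃ x₄ : Fin 4
x₁ = zero
x₂ = suc zero
x₃ = suc (suc zero)
x₄ = suc (suc (suc zero))

EfficientlyEntails : Rel 4 → (A → A → Set) → (A → A → Set) → Set
EfficientlyEntails R S₁ S₂ =
  ((t : Fin 4 → A) → R t → S₁ (t x₁) (t x₂) → S₂ (t x₃) (t x₄)) ×
  (Σ (Fin 4 → A) λ t → R t × S₁ (t x₁) (t x₂) × S₂ (t x₃) (t x₄)) ×
  (Σ (Fin 4 → A) λ t → R t × ¬ S₁ (t x₁) (t x₂) × ¬ S₂ (t x₃) (t x₄))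

Entails : Rel 4 → Rel 4 → Set
Entails R φ = (t : Fin 4 → A) → R t → φ t

φ₀ : Rel 4
φ₀ t = E⁼ (t x₁) (t x₂) × N (t x₂) (t x₃) × E⁼ (t x₃) (t x₄)

IsImpRel : (A → A → Set) → (A → A → Set) → Rel 4 → Rel 4 → Set
IsImpRel S₁ S₂ φ R = EfficientlyEntails R S₁ S₂ × Entails R φ

-- Both halves reduce to one combinatorial fact (no-equality-implication):
-- if a pp-definable R ⊆ φ₀ contains a tuple of shape (E,E) and one of shape
-- (=,=), then a quasi near-unanimity polymorphism q of arity m refutes the
-- implication x₁ = x₂ ⇒ x₃ = x₄ on R.  Quasi near-unanimity together with
-- preservation of E forces m ≥ 3.  Automorphisms of C²_ω turn the (=,=)-tuple
-- into tuples (w,w,c,c) and (w,w,d,d) for an edge cd; applying q to m suitable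
-- matrices of rows (a,b,c,d), (w,w,c,c), (w,w,d,d) chains q(c,…,c) = q(d,…,d),
-- contradicting E(q(c,…,c), q(d,…,d)).  For the E ⇒ E relation the minority
-- behaviour of h first produces the implication x₁ = x₂ ⇒ x₃ = x₄.
--
-- The argument needs only quasi near-unanimity of q and the minority
-- behaviour of h on {E,=}; oligopotency, canonicity and h(N,·,·) = N are unused.
--
-- Since Agda functions are not extensional,
-- q is replaced by q ∘ normalise, which respects pointwise equality of columns
-- but keeps the quasi near-unanimity of q.
module Submission where

open import Defs
open import Data.Nat using (ℕ)
open import Data.Fin using (Fin)
open import Data.Product using (_×_)
open import Relation.Nullary using (¬_)
open import Relation.Binary.PropositionalEquality using (_≡_)

open import Data.Nat using (zero; suc; _+_; _<_; s≤s; z≤n; _≤?_; _≟_)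
open import Relation.Binary.Definitions using (tri<; tri≈; tri>)
open import Data.Nat.Properties using (<-cmp; <⇒≤; <⇒≱; ≤-reflexive; m<n⇒m<1+n)
open import Data.Fin using (zero; suc; toℕ; fromℕ<)
open import Data.Fin.Properties using (toℕ-fromℕ<; toℕ-injective; toℕ<n; any?; all?)
import Data.Fin.Properties as Fin
open import Data.Bool using (Bool; true; false; _xor_; if_then_else_)
import Data.Bool.Properties as Bool
open import Data.Bool.Properties using (xor-assoc; xor-same; xor-identityʳ)
open import Data.Product using (∃; ∃₂; _,_; proj₁; proj₂)
open import Data.Product.Properties using (≡-dec)
open import Data.Sum using (inj₁; inj₂)
open import Data.Empty using (⊥-elim)
open import Data.Vec using (Vec; lookup; tabulate)
open import Data.Vec.Properties using (lookup∘tabulate; tabulate-cong)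
open import Data.Vec.Functional using (_∷_; []; updateAt)
open import Data.Vec.Functional.Properties using (updateAt-updates; updateAt-minimal)
open import Function using (id; _∘_; const)
open import Relation.Nullary using (Dec; yes; no; does; ¬?)
open import Relation.Nullary.Decidable using (_→-dec_)
open import Relation.Binary.PropositionalEquality using (refl; sym; trans; cong; cong₂; subst₂; _≢_)

if-yes : ∀ {P X : Set} (d : Dec P) {x y : X} → P → (if does d then x else y) ≡ x
if-yes (yes _) _ = refl
if-yes (no ¬p) p = ⊥-elim (¬p p)

if-no : ∀ {P X : Set} (d : Dec P) {x y : X} → ¬ P → (if does d then x else y) ≡ y
if-no (yes p) ¬p = ⊥-elim (¬p p)
if-no (no _) _ = refl

pointwise4 : {t u : Fin 4 → A} → t x₁ ≡ u x₁ → t x₂ ≡ u x₂ → t x₃ ≡ u x₃ → t x₄ ≡ u x₄ →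
  ∀ i → t i ≡ u i
pointwise4 e₁ e₂ e₃ e₄ zero = e₁
pointwise4 e₁ e₂ e₃ e₄ (suc zero) = e₂
pointwise4 e₁ e₂ e₃ e₄ (suc (suc zero)) = e₃
pointwise4 e₁ e₂ e₃ e₄ (suc (suc (suc zero))) = e₄

E-irrefl : (a : A) → ¬ E a a
E-irrefl a (_ , b≢b) = b≢b refl

N⇒differentEdges : {a b : A} → N a b → proj₁ a ≢ proj₁ b
N⇒differentEdges {i , b} {.i , c} (a≢b , ¬Eab) refl with b Bool.≟ c
... | yes refl = a≢b refl
... | no b≢c = ¬Eab (refl , b≢c)

E⁼-¬E⇒≡ : {a b : A} → E⁼ a b → ¬ E a b → a ≡ b
E⁼-¬E⇒≡ (inj₁ e) ¬e = ⊥-elim (¬e e)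
E⁼-¬E⇒≡ (inj₂ a≡b) _ = a≡b

E⁼-≢⇒E : {a b : A} → E⁼ a b → a ≢ b → E a b
E⁼-≢⇒E (inj₁ e) _ = e
E⁼-≢⇒E (inj₂ a≡b) a≢b = ⊥-elim (a≢b a≡b)

idAut : IsAut id
idAut = (id , (λ _ → refl) , (λ _ → refl)) , (λ _ _ → id , id)

aut-injective : ∀ {α} → IsAut α → ∀ {a b} → α a ≡ α b → a ≡ b
aut-injective ((α⁻¹ , α⁻¹α , _) , _) {a} {b} e = trans (sym (α⁻¹α a)) (trans (cong α⁻¹ e) (α⁻¹α b))

extend-related : ∀ {n} (α : A → A) {ρ ρ' : Fin n → A} {a a' : A} →
  a' ≡ α a → (∀ i → ρ' i ≡ α (ρ i)) → ∀ i → (a' ∷ ρ') i ≡ α ((a ∷ ρ) i)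
extend-related α e _ zero = e
extend-related α _ es (suc i) = es i

-- An automorphism α maps satisfying assignments of any formula to satisfying assignments
-- (both directions are needed for negation and implication).
FO-aut : ∀ {n α} → IsAut α → (φ : FO n) (ρ ρ' : Fin n → A) → (∀ i → ρ' i ≡ α (ρ i)) →
  (⟦ φ ⟧FO ρ → ⟦ φ ⟧FO ρ') × (⟦ φ ⟧FO ρ' → ⟦ φ ⟧FO ρ)
FO-aut au falseF ρ ρ' e = id , id
FO-aut {α = α} au (eqF i j) ρ ρ' e =
  (λ p → trans (e i) (trans (cong α p) (sym (e j)))) ,
  (λ p → aut-injective au (trans (sym (e i)) (trans p (e j))))
FO-aut au (edgeF i j) ρ ρ' e =
  (λ p → subst₂ E (sym (e i)) (sym (e j)) (proj₁ (proj₂ au (ρ i) (ρ j)) p)) ,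
  (λ p → proj₂ (proj₂ au (ρ i) (ρ j)) (subst₂ E (e i) (e j) p))
FO-aut au (notF φ) ρ ρ' e =
  (λ ¬p p' → ¬p (proj₂ (FO-aut au φ ρ ρ' e) p')) , (λ ¬p' p → ¬p' (proj₁ (FO-aut au φ ρ ρ' e) p))
FO-aut au (andF φ ψ) ρ ρ' e =
  (λ (p , r) → proj₁ (FO-aut au φ ρ ρ' e) p , proj₁ (FO-aut au ψ ρ ρ' e) r) ,
  (λ (p , r) → proj₂ (FO-aut au φ ρ ρ' e) p , proj₂ (FO-aut au ψ ρ ρ' e) r)
FO-aut au (orF φ ψ) ρ ρ' e =
  (λ { (inj₁ p) → inj₁ (proj₁ (FO-aut au φ ρ ρ' e) p) ; (inj₂ r) → inj₂ (proj₁ (FO-aut au ψ ρ ρ' e) r) }) ,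
  (λ { (inj₁ p) → inj₁ (proj₂ (FO-aut au φ ρ ρ' e) p) ; (inj₂ r) → inj₂ (proj₂ (FO-aut au ψ ρ ρ' e) r) })
FO-aut au (impF φ ψ) ρ ρ' e =
  (λ f p' → proj₁ (FO-aut au ψ ρ ρ' e) (f (proj₂ (FO-aut au φ ρ ρ' e) p'))) ,
  (λ f p → proj₂ (FO-aut au ψ ρ ρ' e) (f (proj₁ (FO-aut au φ ρ ρ' e) p)))
FO-aut {α = α} au@((α⁻¹ , _ , αα⁻¹) , _) (allF φ) ρ ρ' e =
  (λ H a' → proj₁ (FO-aut au φ (α⁻¹ a' ∷ ρ) (a' ∷ ρ') (extend-related α (sym (αα⁻¹ a')) e)) (H (α⁻¹ a'))) ,
  (λ H a → proj₂ (FO-aut au φ (a ∷ ρ) (α a ∷ ρ') (extend-related α refl e)) (H (α a)))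
FO-aut {α = α} au@((α⁻¹ , _ , αα⁻¹) , _) (exF φ) ρ ρ' e =
  (λ (a , p) → α a , proj₁ (FO-aut au φ (a ∷ ρ) (α a ∷ ρ') (extend-related α refl e)) p) ,
  (λ (a' , p) → α⁻¹ a' , proj₂ (FO-aut au φ (α⁻¹ a' ∷ ρ) (a' ∷ ρ') (extend-related α (sym (αα⁻¹ a')) e)) p)

-- The basic relations of an expansion are first-order definable, hence invariant.
rel-aut : ∀ 𝔸 r {α} → IsAut α → (t t' : Fin (arity 𝔸 r) → A) → (∀ i → t' i ≡ α (t i)) →
  rel 𝔸 r t → rel 𝔸 r t'
rel-aut 𝔸 r au t t' e Rt with fo 𝔸 r
... | φ , def = proj₂ (def t') (proj₁ (FO-aut au φ t t' e) (proj₁ (def t) Rt))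

PP-aut : ∀ {𝔸 n α} → IsAut α → (φ : PP 𝔸 n) (ρ ρ' : Fin n → A) → (∀ i → ρ' i ≡ α (ρ i)) →
  ⟦ φ ⟧PP ρ → ⟦ φ ⟧PP ρ'
PP-aut au (eqP i j) ρ ρ' e = proj₁ (FO-aut au (eqF i j) ρ ρ' e)
PP-aut au (edgeP i j) ρ ρ' e = proj₁ (FO-aut au (edgeF i j) ρ ρ' e)
PP-aut {𝔸} au (relP r σ) ρ ρ' e = rel-aut 𝔸 r au (ρ ∘ σ) (ρ' ∘ σ) (e ∘ σ)
PP-aut au (andP φ ψ) ρ ρ' e (p , r) = PP-aut au φ ρ ρ' e p , PP-aut au ψ ρ ρ' e r
PP-aut {α = α} au (exP φ) ρ ρ' e (a , p) = α a , PP-aut au φ (a ∷ ρ) (α a ∷ ρ') (extend-related α refl e) p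

PPDefinable-aut : ∀ {𝔸 n α} {R : Rel n} → PPDefinable 𝔸 R → IsAut α →
  (t t' : Fin n → A) → (∀ i → t' i ≡ α (t i)) → R t → R t'
PPDefinable-aut (φ , def) au t t' e Rt = proj₂ (def t') (PP-aut au φ t t' e (proj₁ (def t) Rt))

PPDefinable-resp : ∀ {𝔸 n} {R : Rel n} → PPDefinable 𝔸 R → {t t' : Fin n → A} →
  R t → (∀ i → t' i ≡ t i) → R t'
PPDefinable-resp defR Rt e = PPDefinable-aut defR idAut _ _ e Rt

Extensional : ∀ {m} → Op m → Set
Extensional O = ∀ f g → (∀ i → f i ≡ g i) → O f ≡ O g

PP-preserved : ∀ {𝔸 m n} {O : Op m} → Extensional O → PreservesStr 𝔸 O →
  (φ : PP 𝔸 n) → Preserves O ⟦ φ ⟧PP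
PP-preserved ext pO (eqP i j) t H = ext _ _ H
PP-preserved ext (pE , _) (edgeP i j) t H = pE (λ l → t l i ∷ t l j ∷ []) H
PP-preserved ext (_ , pR) (relP r σ) t H = pR r (λ l → t l ∘ σ) H
PP-preserved ext pO (andP φ ψ) t H =
  PP-preserved ext pO φ t (proj₁ ∘ H) , PP-preserved ext pO ψ t (proj₂ ∘ H)
PP-preserved {O = O} ext pO (exP φ) t H =
  O (λ l → proj₁ (H l)) ,
  PP-aut idAut φ _ _ (λ { zero → refl ; (suc j) → refl })
    (PP-preserved ext pO φ (λ l → proj₁ (H l) ∷ t l) (λ l → proj₂ (H l)))

PPDefinable-preserved : ∀ {𝔸 m n} {O : Op m} {R : Rel n} → PPDefinable 𝔸 R →
  Extensional O → PreservesStr 𝔸 O → Preserves O R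
PPDefinable-preserved (φ , def) ext pO t H =
  proj₂ (def _) (PP-preserved ext pO φ t (λ l → proj₁ (def (t l)) (H l)))

ternaryOp-extensional : (h : A → A → A → A) → Extensional (ternaryOp h)
ternaryOp-extensional h f g e = cong₂ (λ x (yz : A × A) → h x (proj₁ yz) (proj₂ yz))
  (e zero) (cong₂ _,_ (e (suc zero)) (e (suc (suc zero))))

-- normalise f is pointwise equal to f and depends only on the values of f;
-- when f is constant outside one position it is literally of the form
-- updateAt (const x) i (const y), so that quasi near-unanimity applies to it.

ConstantOutside : ∀ {m} → Vec A m → Fin m → Fin m → Set
ConstantOutside v j i = ∀ l → l ≢ i → lookup v l ≡ lookup v j

constantOutside? : ∀ {m} (v : Vec A m) → Dec (∃₂ λ j i → ConstantOutside v j i)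
constantOutside? v = any? λ j → any? λ i → all? λ l →
  ¬? (l Fin.≟ i) →-dec ≡-dec _≟_ Bool._≟_ (lookup v l) (lookup v j)

normalForm : ∀ {m} (v : Vec A m) → Dec (∃₂ λ j i → ConstantOutside v j i) → Fin m → A
normalForm v (yes (j , i , _)) = updateAt (const (lookup v j)) i (const (lookup v i))
normalForm v (no _) = lookup v

normalForm-pointwise : ∀ {m} (v : Vec A m) d l → normalForm v d l ≡ lookup v l
normalForm-pointwise v (yes (j , i , _)) l with l Fin.≟ i
... | yes refl = updateAt-updates l (const (lookup v j))
normalForm-pointwise v (yes (j , i , const-v)) l | no l≢i =
  trans (updateAt-minimal l i (const (lookup v j)) l≢i) (sym (const-v l l≢i))
normalForm-pointwise v (no _) l = refl

avoid2 : ∀ {n} (i i' : Fin (3 + n)) → ∃ λ l → l ≢ i × l ≢ i'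
avoid2 zero zero = suc zero , (λ ()) , (λ ())
avoid2 zero (suc zero) = suc (suc zero) , (λ ()) , (λ ())
avoid2 zero (suc (suc _)) = suc zero , (λ ()) , (λ ())
avoid2 (suc zero) zero = suc (suc zero) , (λ ()) , (λ ())
avoid2 (suc (suc _)) zero = suc zero , (λ ()) , (λ ())
avoid2 (suc _) (suc _) = zero , (λ ()) , (λ ())

normalForm-QNU : ∀ {n} (q : Op (3 + n)) → QuasiNU q → (v : Vec A (3 + n)) (x : A) (i₀ : Fin (3 + n)) →
  (∀ l → l ≢ i₀ → lookup v l ≡ x) → ∀ d → q (normalForm v d) ≡ q (const x)
normalForm-QNU q qnu v x i₀ v≈x (yes (j , i , const-v)) with avoid2 i i₀
... | l , l≢i , l≢i₀ =
  trans (qnu (lookup v j) (lookup v i) i) (cong (q ∘ const) (trans (sym (const-v l l≢i)) (v≈x l l≢i₀)))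
normalForm-QNU q qnu v x i₀ v≈x (no ¬const) with avoid2 i₀ i₀
... | l , l≢i₀ , _ = ⊥-elim (¬const (l , i₀ , λ l' l'≢i₀ → trans (v≈x l' l'≢i₀) (sym (v≈x l l≢i₀))))

-- Kept abstract: unfolding the decision procedure makes type checking explode.
abstract
 normalise : ∀ {m} → (Fin m → A) → Fin m → A
 normalise f = normalForm (tabulate f) (constantOutside? (tabulate f))

 normalise-pointwise : ∀ {m} (f : Fin m → A) l → normalise f l ≡ f l
 normalise-pointwise f l =
   trans (normalForm-pointwise (tabulate f) (constantOutside? (tabulate f)) l) (lookup∘tabulate f l)

 normalise-extensional : ∀ {m} (q : Op m) → Extensional (q ∘ normalise)
 normalise-extensional q f g e = cong (λ v → q (normalForm v (constantOutside? v))) (tabulate-cong e)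

 normalise-QNU : ∀ {n} (q : Op (3 + n)) → QuasiNU q → (f : Fin (3 + n) → A) (x : A) (i₀ : Fin (3 + n)) →
   (∀ l → l ≢ i₀ → f l ≡ x) → q (normalise f) ≡ q (const x)
 normalise-QNU q qnu f x i₀ f≈x =
   normalForm-QNU q qnu (tabulate f) x i₀ (λ l l≢i₀ → trans (lookup∘tabulate f l) (f≈x l l≢i₀))
     (constantOutside? (tabulate f))

-- q ∘ normalise inherits all polymorphism properties of q, since the basic
-- relations respect pointwise equality.
normalise-preserves : ∀ {𝔸 m} {q : Op m} → PreservesStr 𝔸 q → PreservesStr 𝔸 (q ∘ normalise)
normalise-preserves {𝔸} (pE , pR) =
  (λ t H → pE (λ l j → normalise (λ l' → t l' j) l)
              (λ l → subst₂ E (sym (normalise-pointwise _ l)) (sym (normalise-pointwise _ l)) (H l))) ,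
  (λ r t H → pR r (λ l j → normalise (λ l' → t l' j) l)
              (λ l → rel-aut 𝔸 r idAut (t l) _ (λ j → normalise-pointwise _ l) (H l)))

-- A quasi near-unanimity operation maps two nearly constant columns with the
-- same majority value to the same vertex, so it cannot separate them by E.
qnu-no-edge : ∀ {m} {q : Op m} → QuasiNU q → Preserves q Erel → ∀ x y y' i i' →
  ¬ (∀ l → E (updateAt (const x) i (const y) l) (updateAt (const x) i' (const y') l))
qnu-no-edge {q = q} qnu pE x y y' i i' rowsE =
  E-irrefl (q (const x)) (subst₂ E (qnu x y i) (qnu x y' i')
    (pE (λ l → updateAt (const x) i (const y) l ∷ updateAt (const x) i' (const y') l ∷ []) rowsE))

quasiNU-arity : ∀ {m} (q : Op m) → QuasiNU q → Preserves q Erel → ∃ λ n → m ≡ 3 + n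
quasiNU-arity {0} q qnu pE = ⊥-elim (E-irrefl _ (pE (λ i _ → noValue i) (λ ())))
  where
  noValue : Fin 0 → A
  noValue ()
quasiNU-arity {1} q qnu pE =
  ⊥-elim (qnu-no-edge {q = q} qnu pE (0 , true) (0 , true) (0 , false) zero zero λ { zero → refl , λ () })
quasiNU-arity {2} q qnu pE =
  ⊥-elim (qnu-no-edge {q = q} qnu pE (0 , true) (0 , false) (0 , false) zero (suc zero)
    λ { zero → refl , (λ ()) ; (suc zero) → refl , (λ ()) })
quasiNU-arity {suc (suc (suc n))} q qnu pE = n , refl

xor-cancelʳ : ∀ b s → (b xor s) xor s ≡ b
xor-cancelʳ b s = trans (xor-assoc b s s) (trans (cong (b xor_) (xor-same s)) (xor-identityʳ b))

xor-injectiveʳ : ∀ {b c} s → b xor s ≡ c xor s → b ≡ c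
xor-injectiveʳ {b} {c} s e = trans (sym (xor-cancelʳ b s)) (trans (cong (_xor s) e) (xor-cancelʳ c s))

edgeMap : (ℕ → ℕ) → (ℕ → Bool) → A → A
edgeMap σ s (n , b) = σ n , b xor s n

edgeMap-E : ∀ {σ} → (∀ n → σ (σ n) ≡ n) → (s : ℕ → Bool) → (a a' : A) →
  (E a a' → E (edgeMap σ s a) (edgeMap σ s a')) × (E (edgeMap σ s a) (edgeMap σ s a') → E a a')
edgeMap-E {σ} invol s (n , b) (n' , b') = forward , backward
  where
  forward : E (n , b) (n' , b') → E (edgeMap σ s (n , b)) (edgeMap σ s (n' , b'))
  forward (refl , b≢b') = refl , (λ e → b≢b' (xor-injectiveʳ (s n) e))
  backward : E (edgeMap σ s (n , b)) (edgeMap σ s (n' , b')) → E (n , b) (n' , b')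
  backward (σn≡σn' , ne) with trans (sym (invol n)) (trans (cong σ σn≡σn') (invol n'))
  ... | refl = refl , (λ b≡b' → ne (cong (_xor s n) b≡b'))

edgeMap-aut : ∀ {σ} → (∀ n → σ (σ n) ≡ n) → (s : ℕ → Bool) → IsAut (edgeMap σ s)
edgeMap-aut {σ} invol s = (inverse , left , right) , edgeMap-E invol s
  where
  inverse : A → A
  inverse (n , b) = σ n , b xor s (σ n)
  left : ∀ a → inverse (edgeMap σ s a) ≡ a
  left (n , b) rewrite invol n = cong (n ,_) (xor-cancelʳ b (s n))
  right : ∀ a → edgeMap σ s (inverse a) ≡ a
  right (n , b) rewrite invol n = cong (n ,_) (xor-cancelʳ b (s (σ n)))

transpose : ℕ → ℕ → ℕ → ℕ
transpose i j n = if does (n ≟ i) then j else if does (n ≟ j) then i else n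

transpose-left : ∀ i j → transpose i j i ≡ j
transpose-left i j = if-yes (i ≟ i) refl

transpose-right : ∀ i j → transpose i j j ≡ i
transpose-right i j with j ≟ i
... | yes j≡i = trans (if-yes (j ≟ i) j≡i) j≡i
... | no j≢i = trans (if-no (j ≟ i) j≢i) (if-yes (j ≟ j) refl)

transpose-other : ∀ {i j n} → n ≢ i → n ≢ j → transpose i j n ≡ n
transpose-other {i} {j} {n} n≢i n≢j = trans (if-no (n ≟ i) n≢i) (if-no (n ≟ j) n≢j)

transpose-involutive : ∀ i j n → transpose i j (transpose i j n) ≡ n
transpose-involutive i j n with n ≟ i | n ≟ j
... | yes refl | _ = trans (cong (transpose n j) (transpose-left n j)) (transpose-right n j)
... | no _ | yes refl = trans (cong (transpose i n) (transpose-right i n)) (transpose-left i n)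
... | no n≢i | no n≢j = trans (cong (transpose i j) fixed) fixed
  where
  fixed : transpose i j n ≡ n
  fixed = transpose-other n≢i n≢j

onEdge : ℕ → Bool → ℕ → Bool
onEdge j b n = if does (n ≟ j) then b else false

moveTo : A → A → A → A
moveTo v c = edgeMap (transpose (proj₁ v) (proj₁ c)) (onEdge (proj₁ v) (proj₂ v xor proj₂ c))

moveTo-aut : ∀ v c → IsAut (moveTo v c)
moveTo-aut v c = edgeMap-aut (transpose-involutive (proj₁ v) (proj₁ c)) _

moveTo-sends : ∀ v c → moveTo v c v ≡ c
moveTo-sends (i , b) (j , c) = cong₂ _,_ (transpose-left i j) (trans (cong (b xor_) (if-yes (i ≟ i) refl))
  (trans (sym (xor-assoc b b c)) (cong (_xor c) (xor-same b))))

flipEdge : ℕ → A → A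
flipEdge j = edgeMap id (onEdge j true)

flipEdge-aut : ∀ j → IsAut (flipEdge j)
flipEdge-aut j = edgeMap-aut (λ _ → refl) _

flip-distinct : ∀ {b b'} → b ≢ b' → b xor true ≡ b'
flip-distinct {true} {true} ne = ⊥-elim (ne refl)
flip-distinct {true} {false} ne = refl
flip-distinct {false} {true} ne = refl
flip-distinct {false} {false} ne = ⊥-elim (ne refl)

flipEdge-swaps : ∀ {c d} → E c d → flipEdge (proj₁ c) c ≡ d
flipEdge-swaps {i , b} {.i , b'} (refl , b≢b') =
  cong (i ,_) (trans (cong (b xor_) (if-yes (i ≟ i) refl)) (flip-distinct b≢b'))

flipEdge-fixes : ∀ {j w} → proj₁ w ≢ j → flipEdge j w ≡ w
flipEdge-fixes {j} {n , b} n≢j = cong (n ,_) (trans (cong (b xor_) (if-no (n ≟ j) n≢j)) (xor-identityʳ b))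

twin-tuples : ∀ {𝔸} (R : Rel 4) → PPDefinable 𝔸 R → Entails R φ₀ →
  (t : Fin 4 → A) → R t → t x₁ ≡ t x₂ → t x₃ ≡ t x₄ → {c d : A} → E c d →
  ∃ λ w → R (w ∷ w ∷ c ∷ c ∷ []) × R (w ∷ w ∷ d ∷ d ∷ [])
twin-tuples R defR ent t Rt t₁≡t₂ t₃≡t₄ {c} {d} Ecd = w , Rwwcc , Rwwdd
  where
  α : A → A
  α = moveTo (t x₃) c
  w : A
  w = α (t x₁)
  Rwwcc : R (w ∷ w ∷ c ∷ c ∷ [])
  Rwwcc = PPDefinable-aut defR (moveTo-aut (t x₃) c) t _
    (pointwise4 refl (cong α t₁≡t₂) (sym (moveTo-sends (t x₃) c))
      (trans (sym (moveTo-sends (t x₃) c)) (cong α t₃≡t₄))) Rt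
  w-off-edge : proj₁ w ≢ proj₁ c
  w-off-edge = N⇒differentEdges (proj₁ (proj₂ (ent _ Rwwcc)))
  Rwwdd : R (w ∷ w ∷ d ∷ d ∷ [])
  Rwwdd = PPDefinable-aut defR (flipEdge-aut (proj₁ c)) _ _
    (pointwise4 (sym (flipEdge-fixes w-off-edge)) (sym (flipEdge-fixes w-off-edge))
      (sym (flipEdge-swaps Ecd)) (sym (flipEdge-swaps Ecd))) Rwwcc

telescope : ∀ {X : Set} (F : ℕ → X) n → (∀ i → i < n → F i ≡ F (suc i)) → F 0 ≡ F n
telescope F zero steps = refl
telescope F (suc n) steps =
  trans (telescope F n (λ i i<n → steps i (m<n⇒m<1+n i<n))) (steps n (s≤s (≤-reflexive refl)))

marked : ∀ {m} → ℕ → A → A → Fin m → A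
marked i x w l = if does (toℕ l ≟ i) then x else w

threshold : ∀ {m} → ℕ → A → A → Fin m → A
threshold j c d l = if does (j ≤? toℕ l) then c else d

-- Row l of the i-th matrix: (a,b,c,d) if l = i, (w,w,c,c) if l > i, (w,w,d,d) if l < i.
chainRow : ∀ {m} → A → A → A → A → A → ℕ → Fin m → Fin 4 → A
chainRow a b c d w i l =
  marked i a w l ∷ marked i b w l ∷ threshold i c d l ∷ threshold (suc i) c d l ∷ []

chainRow-∈ : ∀ {𝔸 m} {R : Rel 4} → PPDefinable 𝔸 R → ∀ {a b c d w} →
  R (a ∷ b ∷ c ∷ d ∷ []) → R (w ∷ w ∷ c ∷ c ∷ []) → R (w ∷ w ∷ d ∷ d ∷ []) →
  ∀ i (l : Fin m) → R (chainRow a b c d w i l)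
chainRow-∈ defR Rabcd Rwwcc Rwwdd i l with <-cmp (toℕ l) i
... | tri< l<i l≢i _ = PPDefinable-resp defR Rwwdd
  (pointwise4 (if-no (toℕ l ≟ i) l≢i) (if-no (toℕ l ≟ i) l≢i)
    (if-no (i ≤? toℕ l) (<⇒≱ l<i)) (if-no (suc i ≤? toℕ l) (<⇒≱ (m<n⇒m<1+n l<i))))
... | tri≈ _ l≡i _ = PPDefinable-resp defR Rabcd
  (pointwise4 (if-yes (toℕ l ≟ i) l≡i) (if-yes (toℕ l ≟ i) l≡i)
    (if-yes (i ≤? toℕ l) (≤-reflexive (sym l≡i))) (if-no (suc i ≤? toℕ l) (<⇒≱ (s≤s (≤-reflexive l≡i)))))
... | tri> _ l≢i i<l = PPDefinable-resp defR Rwwcc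
  (pointwise4 (if-no (toℕ l ≟ i) l≢i) (if-no (toℕ l ≟ i) l≢i)
    (if-yes (i ≤? toℕ l) (<⇒≤ i<l)) (if-yes (suc i ≤? toℕ l) i<l))

marked-outside : ∀ {m i} (i<m : i < m) {x w} l → l ≢ fromℕ< i<m → marked i x w l ≡ w
marked-outside {i = i} i<m l l≢i =
  if-no (toℕ l ≟ i) (λ l≡i → l≢i (toℕ-injective (trans l≡i (sym (toℕ-fromℕ< i<m)))))

-- Applying q ∘ normalise to the m chain matrices equates q(c,…,c) and
-- q(d,…,d), which contradicts preservation of the edge cd.
chain-contradiction : ∀ {𝔸 n} (q : Op (3 + n)) → QuasiNU q → PreservesStr 𝔸 q →
  (R : Rel 4) → PPDefinable 𝔸 R → ∀ {a b c d w} →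
  R (a ∷ b ∷ c ∷ d ∷ []) → R (w ∷ w ∷ c ∷ c ∷ []) → R (w ∷ w ∷ d ∷ d ∷ []) → E c d →
  ¬ (∀ u → R u → u x₁ ≡ u x₂ → u x₃ ≡ u x₄)
chain-contradiction {𝔸} {n} q qnu pq R defR {a} {b} {c} {d} {w} Rabcd Rwwcc Rwwdd Ecd impl =
  E-irrefl (q (const d)) (subst₂ E qc≡qd refl (proj₁ pq (λ _ → c ∷ d ∷ []) (λ _ → Ecd)))
  where
  Q : Op (3 + n)
  Q = q ∘ normalise
  step : ∀ i → i < 3 + n → Q (threshold i c d) ≡ Q (threshold (suc i) c d)
  step i i<m = impl _
    (PPDefinable-preserved defR (normalise-extensional q) (normalise-preserves {𝔸} {q = q} pq)
      (chainRow a b c d w i) (chainRow-∈ defR Rabcd Rwwcc Rwwdd i))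
    (trans (normalise-QNU q qnu (marked i a w) w (fromℕ< i<m) (marked-outside i<m))
      (sym (normalise-QNU q qnu (marked i b w) w (fromℕ< i<m) (marked-outside i<m))))
  all-c : Q (threshold 0 c d) ≡ q (const c)
  all-c = normalise-QNU q qnu (threshold 0 c d) c zero (λ l _ → if-yes (0 ≤? toℕ l) {c} {d} z≤n)
  all-d : Q (threshold (3 + n) c d) ≡ q (const d)
  all-d = normalise-QNU q qnu (threshold (3 + n) c d) d zero (λ l _ → if-no (3 + n ≤? toℕ l) (<⇒≱ (toℕ<n l)))
  qc≡qd : q (const c) ≡ q (const d)
  qc≡qd = trans (sym all-c) (trans (telescope (λ i → Q (threshold i c d)) (3 + n) step) all-d)

no-equality-implication : ∀ {𝔸 m} (q : Op m) → QuasiNU q → PreservesStr 𝔸 q →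
  (R : Rel 4) → PPDefinable 𝔸 R → Entails R φ₀ →
  (s : Fin 4 → A) → R s → E (s x₃) (s x₄) →
  (t : Fin 4 → A) → R t → t x₁ ≡ t x₂ → t x₃ ≡ t x₄ →
  ¬ (∀ u → R u → u x₁ ≡ u x₂ → u x₃ ≡ u x₄)
no-equality-implication q qnu pq R defR ent s Rs Es₃s₄ t Rt t₁≡t₂ t₃≡t₄
  with quasiNU-arity q qnu (proj₁ pq) | twin-tuples R defR ent t Rt t₁≡t₂ t₃≡t₄ Es₃s₄
... | _ , refl | _ , Rwwcc , Rwwdd =
  chain-contradiction q qnu pq R defR (PPDefinable-resp defR Rs (pointwise4 refl refl refl refl))
    Rwwcc Rwwdd Es₃s₄

-- The minority behaviour of h on {E,=} turns an efficient E ⇒ E entailment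
-- within φ₀ into the implication x₁ = x₂ ⇒ x₃ = x₄: otherwise h applied to
-- (t, u, s) yields a tuple of shape (E,=).
minority-equality-implication : ∀ {𝔸} (h : A → A → A → A) → PreservesStr 𝔸 (ternaryOp h) →
  HOrb h oEq oEq oE oE → HOrb h oEq oE oE oEq →
  (R : Rel 4) → PPDefinable 𝔸 R → Entails R φ₀ → (∀ u → R u → E (u x₁) (u x₂) → E (u x₃) (u x₄)) →
  (s : Fin 4 → A) → R s → E (s x₁) (s x₂) → E (s x₃) (s x₄) →
  (t : Fin 4 → A) → R t → t x₁ ≡ t x₂ → t x₃ ≡ t x₄ →
  ∀ u → R u → u x₁ ≡ u x₂ → u x₃ ≡ u x₄
minority-equality-implication h ph ==E⇒E =EE⇒= R defR ent E⇒E s Rs Es₁s₂ Es₃s₄ t Rt t₁≡t₂ t₃≡t₄ u Ru u₁≡u₂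
  with proj₂ (proj₂ (ent u Ru))
... | inj₂ u₃≡u₄ = u₃≡u₄
... | inj₁ Eu₃u₄ = ⊥-elim (E-irrefl _ (subst₂ E refl (sym out₃≡out₄) (E⇒E out Rout out₁Eout₂)))
  where
  out : Fin 4 → A
  out j = h (t j) (u j) (s j)
  Rout : R out
  Rout = PPDefinable-preserved defR (ternaryOp-extensional h) ph (t ∷ u ∷ s ∷ [])
    (λ { zero → Rt ; (suc zero) → Ru ; (suc (suc zero)) → Rs })
  out₁Eout₂ : E (out x₁) (out x₂)
  out₁Eout₂ = ==E⇒E _ _ _ _ _ _ t₁≡t₂ u₁≡u₂ Es₁s₂
  out₃≡out₄ : out x₃ ≡ out x₄
  out₃≡out₄ = =EE⇒= _ _ _ _ _ _ t₃≡t₄ Eu₃u₄ Es₃s₄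

mainTheorem19 : (𝔸 : Expansion) →
    (m : ℕ) (q : Op m) → QuasiNU q → Oligopotent 𝔸 q → PreservesStr 𝔸 q →
    (h : A → A → A → A) → Canonical h → PreservesStr 𝔸 (ternaryOp h) →
    NPreserving h → MinorityOnEEq h →
    ((R : Rel 4) → PPDefinable 𝔸 R → ¬ IsImpRel E E φ₀ R)
    × ((R : Rel 4) → PPDefinable 𝔸 R → ¬ IsImpRel _≡_ _≡_ φ₀ R)
mainTheorem19 𝔸 _ q qnu _ pq h _ ph _ (_ , _ , _ , ==E⇒E , _ , =EE⇒= , _ , _) = edgeCase , equalityCase
  where
  -- the tuple without E is an (=,=)-tuple by φ₀; h supplies the equality implication
  edgeCase : (R : Rel 4) → PPDefinable 𝔸 R → ¬ IsImpRel E E φ₀ R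
  edgeCase R defR ((E⇒E , (s , Rs , Es₁s₂ , Es₃s₄) , (t , Rt , ¬Et₁t₂ , ¬Et₃t₄)) , ent) =
    no-equality-implication q qnu pq R defR ent s Rs Es₃s₄ t Rt t₁≡t₂ t₃≡t₄
      (minority-equality-implication h ph ==E⇒E =EE⇒= R defR ent E⇒E s Rs Es₁s₂ Es₃s₄ t Rt t₁≡t₂ t₃≡t₄)
    where
    t₁≡t₂ : t x₁ ≡ t x₂
    t₁≡t₂ = E⁼-¬E⇒≡ (proj₁ (ent t Rt)) ¬Et₁t₂
    t₃≡t₄ : t x₃ ≡ t x₄
    t₃≡t₄ = E⁼-¬E⇒≡ (proj₂ (proj₂ (ent t Rt))) ¬Et₃t₄
  -- the tuple with x₃ ≠ x₄ has E(x₃,x₄) by φ₀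
  equalityCase : (R : Rel 4) → PPDefinable 𝔸 R → ¬ IsImpRel _≡_ _≡_ φ₀ R
  equalityCase R defR ((impl , (t , Rt , t₁≡t₂ , t₃≡t₄) , (s , Rs , _ , s₃≢s₄)) , ent) =
    no-equality-implication q qnu pq R defR ent s Rs
      (E⁼-≢⇒E (proj₂ (proj₂ (ent s Rs))) s₃≢s₄) t Rt t₁≡t₂ t₃≡t₄ impl
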